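{- $\mathrm{FO}(<)\circ\mathsf{SU}=\mathrm{FO}(<)$.
   Context: Words $w\in A^*$ are viewed as logical structures with domain the positions $\{0,\dots,|w|-1\}$. $\mathrm{FO}(<)(A)$ is the class of languages over $A$ definable by first-order sentences using label predicates $a(x)$ ($a\in A$) and the linear order $<$ on positions. $\mathsf{SU}(A)$ is the set of finite Boolean combinations of languages $A^*w$, $w\in A^*$. Enrichment: for a finite partition $\mathbf{P}$ of $A^*$, $[u]_{\mathbf{P}}$ is the block containing $u$; $\tau_{\mathbf{P}}:A^*\to(\mathbf{P}\times A)^*$ maps $a_1\cdots a_n$ to $b_1\cdots b_n$ with $b_i=([a_1\cdots a_{i-1}]_{\mathbf{P}},a_i)$, $\tau_{\mathbf{P}}(\varepsilon)=\varepsilon$. For classes $\mathscr{C},\mathscr{D}$, $(\mathscr{C}\circ\mathscr{D})(A)$ is the set of $L\subseteq A^*$ such that for some finite partition $\mathbf{P}$ of $A^*$ into languages of $\mathscr{D}(A)$ there are $L_P\in\mathscr{C}(\mathbf{P}\times A)$ ($P\in\mathbf{P}$) with $L=\bigcup_{P\in\mathbf{P}}(\tau_{\mathbf{P}}^{ -1}(L_P)\cap P)$. -}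

module Defs where

open import Level using (Lift)
open import Data.Nat using (ℕ; zero; suc)
open import Data.Fin using (Fin; zero; suc; _<_)
open import Data.List using (List; []; _∷_; _++_; length; lookup)
open import Data.Product using (Σ; _×_; _,_; ∃)
open import Data.Sum using (_⊎_)
open import Relation.Nullary using (¬_)
open import Relation.Binary.PropositionalEquality using (_≡_)
open import Function.Bundles using (_↔_; _⇔_)

Language : Set → Set₁
Language A = List A → Set

Class : Set₂
Class = (A : Set) → Language A → Set₁

FiniteAlphabet : Set → Set
FiniteAlphabet A = Σ ℕ (λ n → Fin n ↔ A)

-- Formulas with at most n free variables (de Bruijn indices in Fin n).
data Formula (A : Set) : ℕ → Set where
  lab  : ∀ {n} → A → Fin n → Formula A n
  lt   : ∀ {n} → Fin n → Fin n → Formula A n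
  eq   : ∀ {n} → Fin n → Fin n → Formula A n
  neg  : ∀ {n} → Formula A n → Formula A n
  conj : ∀ {n} → Formula A n → Formula A n → Formula A n
  ex   : ∀ {n} → Formula A (suc n) → Formula A n  -- ∃x (binds index zero)

extend : ∀ {n} {X : Set} → X → (Fin n → X) → Fin (suc n) → X
extend x ρ zero    = x
extend x ρ (suc i) = ρ i

Sat : ∀ {A n} (w : List A) → (Fin n → Fin (length w)) → Formula A n → Set
Sat w ρ (lab a x)  = lookup w (ρ x) ≡ a
Sat w ρ (lt x y)   = ρ x < ρ y
Sat w ρ (eq x y)   = ρ x ≡ ρ y
Sat w ρ (neg φ)    = ¬ Sat w ρ φ
Sat w ρ (conj φ ψ) = Sat w ρ φ × Sat w ρ ψ
Sat w ρ (ex φ)     = Σ (Fin (length w)) (λ p → Sat w (extend p ρ) φ)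

Sentence : Set → Set
Sentence A = Formula A 0

noVar : ∀ {X : Set} → Fin 0 → X
noVar ()

_⊨_ : ∀ {A} → List A → Sentence A → Set
w ⊨ φ = Sat w noVar φ

_≐_ : ∀ {A} → Language A → Language A → Set
L ≐ L' = ∀ w → (L w ⇔ L' w)

FO : Class
FO A L = Lift _ (Σ (Sentence A) (λ φ → L ≐ (λ w → w ⊨ φ)))

data SUExpr (A : Set) : Set where
  suffix : List A → SUExpr A
  compl  : SUExpr A → SUExpr A
  union  : SUExpr A → SUExpr A → SUExpr A
  inter  : SUExpr A → SUExpr A → SUExpr A

⟦_⟧SU : ∀ {A} → SUExpr A → Language A
⟦ suffix w ⟧SU u  = ∃ (λ v → u ≡ v ++ w)
⟦ compl e ⟧SU u   = ¬ ⟦ e ⟧SU u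
⟦ union e f ⟧SU u = ⟦ e ⟧SU u ⊎ ⟦ f ⟧SU u
⟦ inter e f ⟧SU u = ⟦ e ⟧SU u × ⟦ f ⟧SU u

SU : Class
SU A L = Lift _ (Σ (SUExpr A) (λ e → L ≐ ⟦ e ⟧SU))

-- A finite partition of A* into k blocks, given by the map u ↦ [u]_P.
-- Block i is { u | [u]_P ≡ i }.
Partition : Set → ℕ → Set
Partition A k = List A → Fin k

Block : ∀ {A k} → Partition A k → Fin k → Language A
Block P i u = P u ≡ i

-- τ_P, defined via an accumulator holding the prefix read so far
τ-from : ∀ {A k} → Partition A k → List A → List A → List (Fin k × A)
τ-from P pre []       = []
τ-from P pre (a ∷ w)  = (P pre , a) ∷ τ-from P (pre ++ (a ∷ [])) w

τ : ∀ {A k} → Partition A k → List A → List (Fin k × A)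
τ P w = τ-from P [] w

_∘ᶜ_ : Class → Class → Class
(C ∘ᶜ D) A L =
  Σ ℕ (λ k → Σ (Partition A k) (λ P →
    ((i : Fin k) → D A (Block P i)) ×
    Σ (Fin k → Language (Fin k × A)) (λ LP →
      ((i : Fin k) → C (Fin k × A) (LP i)) ×
      (L ≐ (λ w → Σ (Fin k) (λ i → LP i (τ P w) × Block P i w))))))

-- A language in SU is a Boolean combination of suffix tests, and "the prefix
-- of w before position x ends with u" is first-order: walk back from x along
-- |u| successor positions reading u backwards. Hence a letter (j , a) of
-- τ_P(w) at position x can be replaced by "a(x) and the prefix before x lies
-- in block j", which turns each sentence over P × A into a sentence over A
-- with the same meaning on w. The disjunction over the blocks j of these
-- sentences, each conjoined with "w lies in block j", defines L. Conversely,
-- every FO(<) language is an enrichment by the trivial one-block partition.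

module Submission where

open import Defs
open import Level using (lift; lower)
open import Data.Nat as ℕ using (ℕ; zero; suc)
open import Data.Nat.Properties
  using (≤-refl; ≤-trans; ≤-reflexive; <⇒≤; <-irrefl; ≤∧≮⇒≡; suc-injective)
open import Data.Fin as F using (Fin; zero; suc; toℕ; fromℕ<; cast)
open import Data.Fin.Properties
  using (toℕ<n; toℕ-fromℕ<; toℕ-cast; toℕ-injective; _<?_; any?; ⊎⇔∃)
  renaming (_≟_ to _≟ᶠ_)
open import Data.List using (List; []; _∷_; _++_; [_]; _∷ʳ_; length; lookup; take)
open import Data.List.Properties
  using (++-identityʳ; ++-assoc; ++-conicalʳ; ∷ʳ-injective; take-suc; take-all)
open import Data.List.Reverse using (Reverse; []; _∶_∶ʳ_; reverseView)
open import Data.Product using (∃-syntax; _×_; _,_; proj₁; proj₂; uncurry)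
open import Data.Product.Properties using (,-injectiveʳ)
open import Data.Product.Function.NonDependent.Propositional using (_×-⇔_)
open import Data.Sum.Function.Propositional using (_⊎-⇔_)
open import Data.Product.Function.Dependent.Propositional as Σ using ()
open import Data.Product.Relation.Binary.Pointwise.NonDependent using (≡×≡⇒≡; ≡⇒≡×≡)
open import Data.Sum using (_⊎_; inj₁; inj₂; [_,_]′)
open import Data.Empty using (⊥-elim)
open import Function using (_∘_)
open import Function.Bundles using (_⇔_; mk⇔; Equivalence)
open import Function.Construct.Identity using (⇔-id)
open import Function.Construct.Symmetry using (⇔-sym)
open import Function.Properties.Inverse using (↔-sym; ↔⇒↣)
open import Function.Related.Propositional using (module EquationalReasoning)
open import Function.Related.TypeIsomorphisms using (¬-cong-⇔)
open import Relation.Binary using (DecidableEquality)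
open import Relation.Binary.PropositionalEquality
  using (_≡_; refl; sym; trans; cong; cong₂; subst; subst₂)
open import Relation.Nullary using (¬_; Dec; yes; no)
open import Relation.Nullary.Decidable using (_×-dec_; ¬?; decidable-stable; via-injection)

open Equivalence using (to; from)
open EquationalReasoning

private
  variable
    A B : Set
    k n : ℕ

finite⇒decidableEquality : FiniteAlphabet A → DecidableEquality A
finite⇒decidableEquality (_ , Fin↔A) = via-injection (↔⇒↣ (↔-sym Fin↔A)) _≟ᶠ_

sat? : DecidableEquality A → (w : List A) (ρ : Fin n → Fin (length w)) (φ : Formula A n) →
       Dec (Sat w ρ φ)
sat? _≟_ w ρ (lab a x)  = lookup w (ρ x) ≟ a
sat? _≟_ w ρ (lt x y)   = ρ x <? ρ y
sat? _≟_ w ρ (eq x y)   = ρ x ≟ᶠ ρ y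
sat? _≟_ w ρ (neg φ)    = ¬? (sat? _≟_ w ρ φ)
sat? _≟_ w ρ (conj φ ψ) = sat? _≟_ w ρ φ ×-dec sat? _≟_ w ρ ψ
sat? _≟_ w ρ (ex φ)     = any? (λ p → sat? _≟_ w (extend p ρ) φ)

⊤F : Formula A n
⊤F = neg (ex (neg (eq zero zero)))

_∨F_ : Formula A n → Formula A n → Formula A n
φ ∨F ψ = neg (conj (neg φ) (neg ψ))

⋁F : (Fin k → Formula A n) → Formula A n
⋁F {k = zero}  φ = neg ⊤F
⋁F {k = suc k} φ = φ zero ∨F ⋁F (φ ∘ suc)

Sat-⊤F : (w : List A) (ρ : Fin n → Fin (length w)) → Sat w ρ ⊤F
Sat-⊤F w ρ (_ , p≢p) = p≢p refl

module _ (_≟_ : DecidableEquality A) (w : List A) (ρ : Fin n → Fin (length w)) where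

  -- Decidability is what turns the classical disjunction into a sum.
  Sat-∨F : (φ ψ : Formula A n) → Sat w ρ (φ ∨F ψ) ⇔ (Sat w ρ φ ⊎ Sat w ρ ψ)
  Sat-∨F φ ψ = mk⇔ fwd [ (λ s (¬s , _) → ¬s s) , (λ s (_ , ¬s) → ¬s s) ]′
    where
    fwd : Sat w ρ (φ ∨F ψ) → Sat w ρ φ ⊎ Sat w ρ ψ
    fwd h with sat? _≟_ w ρ φ
    ... | yes s = inj₁ s
    ... | no ¬s = inj₂ (decidable-stable (sat? _≟_ w ρ ψ) (λ ¬t → h (¬s , ¬t)))

  Sat-⋁F : (φ : Fin k → Formula A n) → Sat w ρ (⋁F φ) ⇔ (∃[ i ] Sat w ρ (φ i))
  Sat-⋁F {k = zero}  φ = mk⇔ (λ h → ⊥-elim (h (Sat-⊤F w ρ))) (λ ())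
  Sat-⋁F {k = suc k} φ = begin
    Sat w ρ (φ zero ∨F ⋁F (φ ∘ suc))                  ∼⟨ Sat-∨F (φ zero) (⋁F (φ ∘ suc)) ⟩
    (Sat w ρ (φ zero) ⊎ Sat w ρ (⋁F (φ ∘ suc)))       ∼⟨ ⇔-id _ ⊎-⇔ Sat-⋁F (φ ∘ suc) ⟩
    (Sat w ρ (φ zero) ⊎ ∃[ i ] Sat w ρ (φ (suc i)))   ∼⟨ ⊎⇔∃ ⟩
    (∃[ i ] Sat w ρ (φ i))                             ∎

relabel : (∀ {m} → B → Fin m → Formula A m) → Formula B n → Formula A n
relabel θ (lab b x)  = θ b x
relabel θ (lt x y)   = lt x y
relabel θ (eq x y)   = eq x y
relabel θ (neg φ)    = neg (relabel θ φ)
relabel θ (conj φ ψ) = conj (relabel θ φ) (relabel θ ψ)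
relabel θ (ex φ)     = ex (relabel θ φ)

_≈ᵖ_ : ∀ {l m} → (Fin n → Fin l) → (Fin n → Fin m) → Set
ρ ≈ᵖ σ = ∀ i → toℕ (ρ i) ≡ toℕ (σ i)

extend-≈ᵖ : ∀ {l m} {ρ : Fin n → Fin l} {σ : Fin n → Fin m} {p q} →
            toℕ p ≡ toℕ q → ρ ≈ᵖ σ → extend p ρ ≈ᵖ extend q σ
extend-≈ᵖ p≈q ρ≈σ zero    = p≈q
extend-≈ᵖ p≈q ρ≈σ (suc i) = ρ≈σ i

module _ (θ : ∀ {m} → B → Fin m → Formula A m) (w : List A) (v : List B)
         (∣w∣≡∣v∣ : length w ≡ length v)
         (θ-defines : ∀ {m} {ρ : Fin m → Fin (length w)} {σ : Fin m → Fin (length v)} →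
                      ρ ≈ᵖ σ → ∀ b x → Sat w ρ (θ b x) ⇔ (lookup v (σ x) ≡ b)) where

  Sat-relabel : (φ : Formula B n) {ρ : Fin n → Fin (length w)} {σ : Fin n → Fin (length v)} →
                ρ ≈ᵖ σ → Sat w ρ (relabel θ φ) ⇔ Sat v σ φ
  Sat-relabel (lab b x)  ρ≈σ = θ-defines ρ≈σ b x
  Sat-relabel (lt x y)   ρ≈σ =
    mk⇔ (subst₂ ℕ._<_ (ρ≈σ x) (ρ≈σ y)) (subst₂ ℕ._<_ (sym (ρ≈σ x)) (sym (ρ≈σ y)))
  Sat-relabel (eq x y)   ρ≈σ =
    mk⇔ (λ e → toℕ-injective (trans (sym (ρ≈σ x)) (trans (cong toℕ e) (ρ≈σ y))))
        (λ e → toℕ-injective (trans (ρ≈σ x) (trans (cong toℕ e) (sym (ρ≈σ y)))))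
  Sat-relabel (neg φ)    ρ≈σ = ¬-cong-⇔ (Sat-relabel φ ρ≈σ)
  Sat-relabel (conj φ ψ) ρ≈σ = Sat-relabel φ ρ≈σ ×-⇔ Sat-relabel ψ ρ≈σ
  Sat-relabel (ex φ) {ρ} {σ} ρ≈σ = mk⇔
    (λ (p , s) → cast ∣w∣≡∣v∣ p , to (IH (sym (toℕ-cast ∣w∣≡∣v∣ p))) s)
    (λ (q , s) → cast (sym ∣w∣≡∣v∣) q , from (IH (toℕ-cast (sym ∣w∣≡∣v∣) q)) s)
    where
    IH : ∀ {p q} → toℕ p ≡ toℕ q → Sat w (extend p ρ) (relabel θ φ) ⇔ Sat v (extend q σ) φ
    IH p≈q = Sat-relabel φ (extend-≈ᵖ p≈q ρ≈σ)

length-τ-from : (P : Partition A k) (pre w : List A) → length (τ-from P pre w) ≡ length w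
length-τ-from P pre []      = refl
length-τ-from P pre (a ∷ w) = cong suc (length-τ-from P (pre ++ [ a ]) w)

lookup-τ-from : (P : Partition A k) (pre w : List A)
                (p : Fin (length (τ-from P pre w))) (q : Fin (length w)) → toℕ p ≡ toℕ q →
                lookup (τ-from P pre w) p ≡ (P (pre ++ take (toℕ q) w) , lookup w q)
lookup-τ-from P pre (a ∷ w) zero    zero    _   = cong (λ u → P u , a) (sym (++-identityʳ pre))
lookup-τ-from P pre (a ∷ w) (suc p) (suc q) p≡q =
  trans (lookup-τ-from P (pre ++ [ a ]) w p q (suc-injective p≡q))
        (cong (λ u → P u , lookup w q) (++-assoc pre [ a ] (take (toℕ q) w)))

succF : Fin n → Fin n → Formula A n
succF y x = conj (lt y x) (neg (ex (conj (lt (suc y) zero) (lt zero (suc x)))))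

lastF : Fin n → Formula A n
lastF y = neg (ex (lt (suc y) zero))

∃-between⇔ : ∀ {m t} → t ℕ.≤ m → (y : Fin m) →
             (∃[ z ] (y F.< z × toℕ z ℕ.< t)) ⇔ (suc (toℕ y) ℕ.< t)
∃-between⇔ t≤m y = mk⇔
  (λ (z , y<z , z<t) → ≤-trans (ℕ.s≤s y<z) z<t)
  (λ y+1<t → fromℕ< (≤-trans y+1<t t≤m) , ≤-reflexive (sym (toℕ-fromℕ< _)) ,
             ≤-trans (≤-reflexive (cong suc (toℕ-fromℕ< _))) y+1<t)

∃-above⇔ : ∀ {m} (y : Fin m) → (∃[ z ] y F.< z) ⇔ (suc (toℕ y) ℕ.< m)
∃-above⇔ y = mk⇔
  (λ (z , y<z) → ≤-trans (ℕ.s≤s y<z) (toℕ<n z))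
  (λ y+1<m → fromℕ< y+1<m , ≤-reflexive (sym (toℕ-fromℕ< y+1<m)))

Sat-succF : (w : List A) (ρ : Fin n → Fin (length w)) (y x : Fin n) →
            Sat w ρ (succF y x) ⇔ (suc (toℕ (ρ y)) ≡ toℕ (ρ x))
Sat-succF w ρ y x = begin
  (ρ y F.< ρ x × ¬ (∃[ z ] (ρ y F.< z × toℕ z ℕ.< toℕ (ρ x))))
    ∼⟨ ⇔-id _ ×-⇔ ¬-cong-⇔ (∃-between⇔ (<⇒≤ (toℕ<n (ρ x))) (ρ y)) ⟩
  (suc (toℕ (ρ y)) ℕ.≤ toℕ (ρ x) × ¬ suc (toℕ (ρ y)) ℕ.< toℕ (ρ x))
    ∼⟨ mk⇔ (uncurry ≤∧≮⇒≡) (λ e → ≤-reflexive e , <-irrefl e) ⟩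
  (suc (toℕ (ρ y)) ≡ toℕ (ρ x)) ∎

Sat-lastF : (w : List A) (ρ : Fin n → Fin (length w)) (y : Fin n) →
            Sat w ρ (lastF y) ⇔ (suc (toℕ (ρ y)) ≡ length w)
Sat-lastF w ρ y = begin
  (¬ (∃[ z ] ρ y F.< z))                ∼⟨ ¬-cong-⇔ (∃-above⇔ (ρ y)) ⟩
  (¬ suc (toℕ (ρ y)) ℕ.< length w)      ∼⟨ mk⇔ (≤∧≮⇒≡ (toℕ<n (ρ y))) <-irrefl ⟩
  (suc (toℕ (ρ y)) ≡ length w)          ∎

_EndsWith_ : List A → List A → Set
X EndsWith u = ⟦ suffix u ⟧SU X

EndsWith-[] : (X : List A) → X EndsWith []
EndsWith-[] X = X , sym (++-identityʳ X)

[]-¬EndsWith-∷ʳ : {u : List A} {c : A} → ¬ ([] EndsWith (u ∷ʳ c))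
[]-¬EndsWith-∷ʳ {u = u} {c} (v , []≡v++u∷ʳc)
  with () ← ++-conicalʳ u [ c ] (++-conicalʳ v (u ∷ʳ c) (sym []≡v++u∷ʳc))

∷ʳ-EndsWith-∷ʳ⇔ : {X u : List A} {c d : A} → (X ∷ʳ d) EndsWith (u ∷ʳ c) ⇔ (d ≡ c × X EndsWith u)
∷ʳ-EndsWith-∷ʳ⇔ {X = X} {u} {c} = mk⇔
  (λ (v , e) → let X≡v++u , d≡c = ∷ʳ-injective X (v ++ u) (trans e (sym (++-assoc v u [ c ])))
               in d≡c , v , X≡v++u)
  (λ (d≡c , v , X≡v++u) → v , trans (cong₂ _∷ʳ_ X≡v++u d≡c) (++-assoc v u [ c ]))

take-suc-EndsWith-∷ʳ⇔ : {u : List A} {c : A} (w : List A) (y : Fin (length w)) →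
  take (suc (toℕ y)) w EndsWith (u ∷ʳ c) ⇔ (lookup w y ≡ c × take (toℕ y) w EndsWith u)
take-suc-EndsWith-∷ʳ⇔ w y rewrite take-suc w y = ∷ʳ-EndsWith-∷ʳ⇔

take-EndsWith-∷ʳ⇔ : {u : List A} {c : A} {t : ℕ} (w : List A) → t ℕ.≤ length w →
  take t w EndsWith (u ∷ʳ c) ⇔
  (∃[ y ] (suc (toℕ y) ≡ t × lookup w y ≡ c × take (toℕ y) w EndsWith u))
take-EndsWith-∷ʳ⇔ {t = zero} w _ = mk⇔ (⊥-elim ∘ []-¬EndsWith-∷ʳ) (λ { (_ , () , _) })
take-EndsWith-∷ʳ⇔ {u = u} {c} {suc t} w t<∣w∣ = mk⇔
  (λ h → y , cong suc y≡t ,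
         to (take-suc-EndsWith-∷ʳ⇔ w y) (subst (λ s → take (suc s) w EndsWith (u ∷ʳ c)) (sym y≡t) h))
  (λ (y , y+1≡t , l , s) →
         subst (λ s → take s w EndsWith (u ∷ʳ c)) y+1≡t (from (take-suc-EndsWith-∷ʳ⇔ w y) (l , s)))
  where
  y = fromℕ< t<∣w∣
  y≡t = toℕ-fromℕ< t<∣w∣

-- ψ singles out (as variable zero) the last position of a prefix of the word;
-- endsWithF ψ u says that this prefix, empty if ψ holds nowhere, ends with u.
endsWithF : {u : List A} → Formula A (suc n) → Reverse u → Formula A n
endsWithF ψ []            = ⊤F
endsWithF ψ (_ ∶ us ∶ʳ c) = ex (conj ψ (conj (lab c zero) (endsWithF (succF zero (suc zero)) us)))

Sat-endsWithF : {u : List A} (w : List A) (ρ : Fin n → Fin (length w)) {t : ℕ} → t ℕ.≤ length w →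
                (ψ : Formula A (suc n)) → (∀ y → Sat w (extend y ρ) ψ ⇔ (suc (toℕ y) ≡ t)) →
                (us : Reverse u) → Sat w ρ (endsWithF ψ us) ⇔ take t w EndsWith u
Sat-endsWithF w ρ t≤∣w∣ ψ ψ-defines [] = mk⇔ (λ _ → EndsWith-[] _) (λ _ → Sat-⊤F w ρ)
Sat-endsWithF w ρ {t} t≤∣w∣ ψ ψ-defines (u ∶ us ∶ʳ c) = begin
  (∃[ y ] (Sat w (extend y ρ) ψ × lookup w y ≡ c ×
           Sat w (extend y ρ) (endsWithF (succF zero (suc zero)) us)))
    ∼⟨ Σ.congˡ (λ {y} → ψ-defines y ×-⇔ ⇔-id _ ×-⇔
                 Sat-endsWithF w (extend y ρ) (<⇒≤ (toℕ<n y)) _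
                               (λ z → Sat-succF w (extend z (extend y ρ)) zero (suc zero)) us) ⟩
  (∃[ y ] (suc (toℕ y) ≡ t × lookup w y ≡ c × take (toℕ y) w EndsWith u))
    ∼⟨ ⇔-sym (take-EndsWith-∷ʳ⇔ w t≤∣w∣) ⟩
  take t w EndsWith (u ∷ʳ c) ∎

prefixInF : Formula A (suc n) → SUExpr A → Formula A n
prefixInF ψ (suffix u)  = endsWithF ψ (reverseView u)
prefixInF ψ (compl e)   = neg (prefixInF ψ e)
prefixInF ψ (union e f) = prefixInF ψ e ∨F prefixInF ψ f
prefixInF ψ (inter e f) = conj (prefixInF ψ e) (prefixInF ψ f)

prefixBeforeF : Fin n → SUExpr A → Formula A n
prefixBeforeF x = prefixInF (succF zero (suc x))

wordInF : SUExpr A → Formula A n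
wordInF = prefixInF (lastF zero)

module _ (_≟_ : DecidableEquality A) (w : List A) (ρ : Fin n → Fin (length w)) where

  Sat-prefixInF : {t : ℕ} → t ℕ.≤ length w → (ψ : Formula A (suc n)) →
                  (∀ y → Sat w (extend y ρ) ψ ⇔ (suc (toℕ y) ≡ t)) →
                  (e : SUExpr A) → Sat w ρ (prefixInF ψ e) ⇔ ⟦ e ⟧SU (take t w)
  Sat-prefixInF t≤∣w∣ ψ ψ-defines (suffix u)  = Sat-endsWithF w ρ t≤∣w∣ ψ ψ-defines (reverseView u)
  Sat-prefixInF t≤∣w∣ ψ ψ-defines (compl e)   = ¬-cong-⇔ (Sat-prefixInF t≤∣w∣ ψ ψ-defines e)
  Sat-prefixInF t≤∣w∣ ψ ψ-defines (union e f) = begin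
    Sat w ρ (prefixInF ψ e ∨F prefixInF ψ f)             ∼⟨ Sat-∨F _≟_ w ρ _ _ ⟩
    (Sat w ρ (prefixInF ψ e) ⊎ Sat w ρ (prefixInF ψ f))  ∼⟨ IH e ⊎-⇔ IH f ⟩
    (⟦ e ⟧SU _ ⊎ ⟦ f ⟧SU _)                               ∎
    where IH = Sat-prefixInF t≤∣w∣ ψ ψ-defines
  Sat-prefixInF t≤∣w∣ ψ ψ-defines (inter e f) =
    Sat-prefixInF t≤∣w∣ ψ ψ-defines e ×-⇔ Sat-prefixInF t≤∣w∣ ψ ψ-defines f

  Sat-prefixBeforeF : (x : Fin n) (e : SUExpr A) →
                      Sat w ρ (prefixBeforeF x e) ⇔ ⟦ e ⟧SU (take (toℕ (ρ x)) w)
  Sat-prefixBeforeF x = Sat-prefixInF (<⇒≤ (toℕ<n (ρ x))) _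
                          (λ y → Sat-succF w (extend y ρ) zero (suc x))

  Sat-wordInF : (e : SUExpr A) → Sat w ρ (wordInF e) ⇔ ⟦ e ⟧SU w
  Sat-wordInF e = subst (λ X → Sat w ρ (wordInF e) ⇔ ⟦ e ⟧SU X) (take-all (length w) w ≤-refl)
                    (Sat-prefixInF ≤-refl _ (λ y → Sat-lastF w (extend y ρ) zero) e)

enrichedLetterF : (Fin k → SUExpr A) → Fin k × A → Fin n → Formula A n
enrichedLetterF e (j , a) x = conj (prefixBeforeF x (e j)) (lab a x)

⊨-relabel-enrichedLetterF : DecidableEquality A → (P : Partition A k) (e : Fin k → SUExpr A) →
                            (∀ i → Block P i ≐ ⟦ e i ⟧SU) →
                            (w : List A) (φ : Sentence (Fin k × A)) →
                            w ⊨ relabel (enrichedLetterF e) φ ⇔ τ P w ⊨ φ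
⊨-relabel-enrichedLetterF _≟_ P e P≐e w φ =
  Sat-relabel (enrichedLetterF e) w (τ P w) (sym (length-τ-from P [] w)) defines φ (λ ())
  where
  defines : ∀ {m} {ρ : Fin m → Fin (length w)} {σ : Fin m → Fin (length (τ P w))} →
            ρ ≈ᵖ σ → ∀ b x → Sat w ρ (enrichedLetterF e b x) ⇔ (lookup (τ P w) (σ x) ≡ b)
  defines {ρ = ρ} {σ} ρ≈σ (j , a) x = begin
    (Sat w ρ (prefixBeforeF x (e j)) × lookup w (ρ x) ≡ a)
      ∼⟨ Sat-prefixBeforeF _≟_ w ρ x (e j) ×-⇔ ⇔-id _ ⟩
    (⟦ e j ⟧SU (take (toℕ (ρ x)) w) × lookup w (ρ x) ≡ a)
      ∼⟨ ⇔-sym (P≐e j _) ×-⇔ ⇔-id _ ⟩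
    (P (take (toℕ (ρ x)) w) ≡ j × lookup w (ρ x) ≡ a)
      ∼⟨ mk⇔ ≡×≡⇒≡ ≡⇒≡×≡ ⟩
    ((P (take (toℕ (ρ x)) w) , lookup w (ρ x)) ≡ (j , a))
      ∼⟨ mk⇔ (trans lookup-σx) (trans (sym lookup-σx)) ⟩
    (lookup (τ P w) (σ x) ≡ (j , a)) ∎
    where lookup-σx = lookup-τ-from P [] w (σ x) (ρ x) (sym (ρ≈σ x))

FO∘SU⊆FO : {L : Language A} → DecidableEquality A → (FO ∘ᶜ SU) A L → FO A L
FO∘SU⊆FO {A = A} {L} _≟_ (k , P , blocks-SU , LP , LP-FO , L≐) = lift (Φ , λ w → begin
  L w
    ∼⟨ L≐ w ⟩
  (∃[ i ] (LP i (τ P w) × Block P i w))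
    ∼⟨ Σ.congˡ (φ-defines _ _ ×-⇔ e-defines _ w) ⟩
  (∃[ i ] (τ P w ⊨ φ i × ⟦ e i ⟧SU w))
    ∼⟨ Σ.congˡ (⇔-sym (⊨-relabel-enrichedLetterF _≟_ P e e-defines w (φ _)
                       ×-⇔ Sat-wordInF _≟_ w noVar (e _))) ⟩
  (∃[ i ] (w ⊨ relabel (enrichedLetterF e) (φ i) × w ⊨ wordInF (e i)))
    ∼⟨ ⇔-sym (Sat-⋁F _≟_ w noVar _) ⟩
  w ⊨ Φ ∎)
  where
  e : Fin k → SUExpr A
  e i = proj₁ (lower (blocks-SU i))

  e-defines : ∀ i → Block P i ≐ ⟦ e i ⟧SU
  e-defines i = proj₂ (lower (blocks-SU i))

  φ : Fin k → Sentence (Fin k × A)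
  φ i = proj₁ (lower (LP-FO i))

  φ-defines : ∀ i → LP i ≐ (λ v → v ⊨ φ i)
  φ-defines i = proj₂ (lower (LP-FO i))

  Φ : Sentence A
  Φ = ⋁F λ i → conj (relabel (enrichedLetterF e) (φ i)) (wordInF (e i))

FO⊆FO∘SU : {L : Language A} → FO A L → (FO ∘ᶜ SU) A L
FO⊆FO∘SU {A = A} {L} (lift (φ , L≐φ)) =
  1 , one-block , (λ { zero → lift (suffix [] , λ u → mk⇔ (λ _ → EndsWith-[] u) (λ _ → refl)) }) ,
  (λ _ v → v ⊨ φ′) , (λ _ → lift (φ′ , λ _ → ⇔-id _)) ,
  λ w → mk⇔ (λ h → zero , from (τ-⊨φ′ w) (to (L≐φ w) h) , refl)
            (λ (_ , s , _) → from (L≐φ w) (to (τ-⊨φ′ w) s))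
  where
  one-block : Partition A 1
  one-block _ = zero

  letterF : ∀ {m} → A → Fin m → Formula (Fin 1 × A) m
  letterF a x = lab (zero , a) x

  φ′ : Sentence (Fin 1 × A)
  φ′ = relabel letterF φ

  τ-⊨φ′ : (w : List A) → τ one-block w ⊨ φ′ ⇔ w ⊨ φ
  τ-⊨φ′ w = Sat-relabel letterF (τ one-block w) w (length-τ-from one-block [] w) defines φ (λ ())
    where
    defines : ∀ {m} {ρ : Fin m → Fin (length (τ one-block w))} {σ : Fin m → Fin (length w)} →
              ρ ≈ᵖ σ → ∀ a x → Sat (τ one-block w) ρ (letterF a x) ⇔ (lookup w (σ x) ≡ a)
    defines {ρ = ρ} {σ} ρ≈σ a x =
      mk⇔ (λ h → ,-injectiveʳ (trans (sym lookup-ρx) h)) (λ h → trans lookup-ρx (cong (zero ,_) h))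
      where lookup-ρx = lookup-τ-from one-block [] w (ρ x) (σ x) (ρ≈σ x)

proposition4p21 : (A : Set) → FiniteAlphabet A → (L : Language A) →
                    ((FO ∘ᶜ SU) A L ⇔ FO A L)
proposition4p21 A finite L = mk⇔ (FO∘SU⊆FO (finite⇒decidableEquality finite)) FO⊆FO∘SU
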